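{- Let $\mathcal{C}$ be a class of instances and let $\mathcal{F}$ be a finite set of instances. If $\mathcal{C}$ admits a left query algorithm over $\mathbb{B}$ of the form $(\mathcal{F},X)$ for some set $X$, then $\mathcal{C}$ admits a left query algorithm over $\mathbb{N}$ of the form $(\mathcal{F},X')$ for some set $X'$. In particular, if $\mathcal{C}$ admits a left query algorithm over $\mathbb{B}$, then it also admits a left query algorithm over $\mathbb{N}$. The same holds for right query algorithms.
   Context: An instance $A$ over a schema assigns to each relation symbol a finite relation of its arity; $\mathrm{adom}(A)$ is the set of entries of its tuples. A homomorphism $A\to B$ is a map $\mathrm{adom}(A)\to\mathrm{adom}(B)$ mapping tuples of each $R^A$ into $R^B$. A class of instances is a collection of instances over a fixed schema closed under isomorphism. $\hom_{\mathbb{N}}(A,B)$ is the number of homomorphisms $A\to B$, $\hom_{\mathbb{B}}(A,B)$ is $1$ if one exists and $0$ otherwise. For $K\in\{\mathbb{B},\mathbb{N}\}$, a left (resp. right) $k$-query algorithm over $K$ for $\mathcal{C}$ is a pair $(\mathcal{F},X)$, $\mathcal{F}=\{F_1,\dots,F_k\}$, $X$ a set of $k$-tuples over $K$, such that for every instance $D$: $D\in\mathcal{C}$ iff $(\hom_K(F_i,D))_{i\le k}\in X$ (resp. $(\hom_K(D,F_i))_{i\le k}\in X$). A left/right query algorithm is a left/right $k$-query algorithm for some $k>0$. -}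

module Defs where

open import Data.Nat using (ℕ; zero; suc; _<_)
open import Data.Bool using (Bool; true; false; not)
open import Data.Fin using (Fin)
open import Data.Fin.Properties using () renaming (_≟_ to _≟ᶠ_)
open import Data.Vec using (Vec; []; _∷_; lookup; tabulate)
import Data.Vec as Vec
open import Data.Vec.Properties using (≡-dec)
import Data.Vec.Membership.Propositional as VM
open import Data.List using (List; [_]; length; filter; concatMap; allFin; null)
import Data.List as List
open import Data.List.Membership.Propositional using (_∈_)
open import Data.List.Membership.DecPropositional using () renaming (_∈?_ to mem?)
open import Data.List.Relation.Unary.All using (All; all?)
open import Data.List.Relation.Unary.Any using (Any)
open import Data.Product using (Σ; ∃-syntax; _×_)
open import Function.Bundles using (Inverse; _⇔_; _↔_)
open import Relation.Nullary using (Dec)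
open import Relation.Binary.PropositionalEquality using (_≡_)

record Schema : Set where
  field
    rel : ℕ
    ar  : Fin rel → ℕ
open Schema public

-- An instance: its active domain is represented by Fin size; each relation
-- symbol is interpreted by a finite list of tuples over the active domain;
-- every element of the domain occurs in some tuple (domain = adom).
record Instance (S : Schema) : Set where
  field
    size   : ℕ
    tuples : (R : Fin (rel S)) → List (Vec (Fin size) (ar S R))
    active : (a : Fin size) → ∃[ R ] Any (λ t → a VM.∈ t) (tuples R)
open Instance public

IsHom : ∀ {S} (A B : Instance S) → (Fin (size A) → Fin (size B)) → Set
IsHom {S} A B h = (R : Fin (rel S)) → All (λ t → Vec.map h t ∈ tuples B R) (tuples A R)

isHom? : ∀ {S} (A B : Instance S) (h : Fin (size A) → Fin (size B)) → Dec (IsHom A B h)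
isHom? {S} A B h = Data.Fin.Properties.all? λ R →
  all? (λ t → mem? (≡-dec _≟ᶠ_) (Vec.map h t) (tuples B R)) (tuples A R)
  where import Data.Fin.Properties

allMaps : (m n : ℕ) → List (Vec (Fin n) m)
allMaps zero    n = [ [] ]
allMaps (suc m) n = concatMap (λ x → List.map (x ∷_) (allMaps m n)) (allFin n)

homs : ∀ {S} (A B : Instance S) → List (Vec (Fin (size B)) (size A))
homs A B = filter (λ v → isHom? A B (lookup v)) (allMaps (size A) (size B))

homℕ : ∀ {S} (A B : Instance S) → ℕ
homℕ A B = length (homs A B)

hom𝔹 : ∀ {S} (A B : Instance S) → Bool
hom𝔹 A B = not (null (homs A B))

record Iso {S : Schema} (A B : Instance S) : Set where
  field
    bij      : Fin (size A) ↔ Fin (size B)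
    preserve : (R : Fin (rel S)) (t : Vec (Fin (size A)) (ar S R)) →
               (t ∈ tuples A R) ⇔ (Vec.map (Inverse.to bij) t ∈ tuples B R)

ClosedUnderIso : ∀ {S} → (Instance S → Set) → Set
ClosedUnderIso {S} C = (A B : Instance S) → Iso A B → C A → C B

LeftAlg : ∀ {S} {K : Set} (homK : Instance S → Instance S → K)
          (C : Instance S → Set) {k : ℕ} (F : Vec (Instance S) k) (X : Vec K k → Set) → Set
LeftAlg homK C F X = ∀ D → C D ⇔ X (Vec.map (λ Fi → homK Fi D) F)

RightAlg : ∀ {S} {K : Set} (homK : Instance S → Instance S → K)
           (C : Instance S → Set) {k : ℕ} (F : Vec (Instance S) k) (X : Vec K k → Set) → Set
RightAlg homK C F X = ∀ D → C D ⇔ X (Vec.map (λ Fi → homK D Fi) F)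

HasLeftQA : ∀ {S} {K : Set} (homK : Instance S → Instance S → K) (C : Instance S → Set) → Set₁
HasLeftQA {S} {K} homK C =
  Σ ℕ λ k → (0 < k) × Σ (Vec (Instance S) k) λ F → Σ (Vec K k → Set) λ X → LeftAlg homK C F X

HasRightQA : ∀ {S} {K : Set} (homK : Instance S → Instance S → K) (C : Instance S → Set) → Set₁
HasRightQA {S} {K} homK C =
  Σ ℕ λ k → (0 < k) × Σ (Vec (Instance S) k) λ F → Σ (Vec K k → Set) λ X → RightAlg homK C F X

{-# OPTIONS --safe #-}

-- The Boolean homomorphism test is a function of the homomorphism count:
-- hom_𝔹(A, B) is true exactly when hom_ℕ(A, B) is positive. So a Boolean
-- acceptance set X is simulated by accepting the count vectors whose
-- positivity pattern lies in X. Right algorithms are left algorithms for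
-- the flipped hom function.

module Submission where

open import Defs
open import Data.Nat using (ℕ; _<_; _≡ᵇ_)
open import Data.Bool using (Bool; not)
open import Data.Vec using (Vec)
import Data.Vec as Vec
open import Data.Vec.Properties using (map-∘; map-cong)
open import Data.List using (List; []; _∷_; null; length)
open import Data.Product using (Σ; _×_; _,_)
open import Function using (_∘_; flip)
open import Function.Bundles using (_⇔_)
open import Relation.Binary.PropositionalEquality using (_≡_; refl; trans; subst)

isPositive : ℕ → Bool
isPositive n = not (n ≡ᵇ 0)

not-null≡isPositive-length : ∀ {A : Set} (xs : List A) → not (null xs) ≡ isPositive (length xs)
not-null≡isPositive-length []      = refl
not-null≡isPositive-length (_ ∷ _) = refl

hom𝔹≡isPositive-homℕ : ∀ {S} (A B : Instance S) → hom𝔹 A B ≡ isPositive (homℕ A B)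
hom𝔹≡isPositive-homℕ A B = not-null≡isPositive-length (homs A B)

module _ {S : Schema} {C : Instance S → Set} {k : ℕ} {F : Vec (Instance S) k} where

  LeftAlg-factor : {K L : Set}
                   (homK : Instance S → Instance S → K) (homL : Instance S → Instance S → L)
                   (f : K → L) → (∀ A B → homL A B ≡ f (homK A B)) →
                   {X : Vec L k → Set} → LeftAlg homL C F X → LeftAlg homK C F (X ∘ Vec.map f)
  LeftAlg-factor homK homL f homL≡f∘homK {X} alg D = subst (λ v → C D ⇔ X v) queries≡ (alg D)
    where
    queries≡ : Vec.map (λ Fi → homL Fi D) F ≡ Vec.map f (Vec.map (λ Fi → homK Fi D) F)
    queries≡ = trans (map-cong (λ Fi → homL≡f∘homK Fi D) F) (map-∘ f (λ Fi → homK Fi D) F)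

  LeftAlg-hom𝔹⇒homℕ : (Σ (Vec Bool k → Set) λ X → LeftAlg hom𝔹 C F X) →
                      Σ (Vec ℕ k → Set) λ X′ → LeftAlg homℕ C F X′
  LeftAlg-hom𝔹⇒homℕ (X , alg) =
    X ∘ Vec.map isPositive , LeftAlg-factor homℕ hom𝔹 isPositive hom𝔹≡isPositive-homℕ {X} alg

  RightAlg-hom𝔹⇒homℕ : (Σ (Vec Bool k → Set) λ X → RightAlg hom𝔹 C F X) →
                       Σ (Vec ℕ k → Set) λ X′ → RightAlg homℕ C F X′
  RightAlg-hom𝔹⇒homℕ (X , alg) =
    X ∘ Vec.map isPositive , LeftAlg-factor (flip homℕ) (flip hom𝔹) isPositive
                                                       (flip hom𝔹≡isPositive-homℕ) {X} alg

proposition4 : (S : Schema) (C : Instance S → Set) → ClosedUnderIso C →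
    ((k : ℕ) → 0 < k → (F : Vec (Instance S) k) →
      (Σ (Vec Bool k → Set) λ X → LeftAlg hom𝔹 C F X) →
      Σ (Vec ℕ k → Set) λ X′ → LeftAlg homℕ C F X′)
    × (HasLeftQA hom𝔹 C → HasLeftQA homℕ C)
    × ((k : ℕ) → 0 < k → (F : Vec (Instance S) k) →
      (Σ (Vec Bool k → Set) λ X → RightAlg hom𝔹 C F X) →
      Σ (Vec ℕ k → Set) λ X′ → RightAlg homℕ C F X′)
    × (HasRightQA hom𝔹 C → HasRightQA homℕ C)
proposition4 S C _ =
  (λ _ _ _ → LeftAlg-hom𝔹⇒homℕ) ,
  (λ { (k , 0<k , F , alg) → k , 0<k , F , LeftAlg-hom𝔹⇒homℕ alg }) ,
  (λ _ _ _ → RightAlg-hom𝔹⇒homℕ) ,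
  (λ { (k , 0<k , F , alg) → k , 0<k , F , RightAlg-hom𝔹⇒homℕ alg })
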